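{- Let $G$ be a bipartite graph and $M$ a matching of $G$. Let $C$ be an $M$-cycle of $G$ and let $P=P[x,y]$ be an $M$-path in $G-V(C)$ with ends $x$ and $y$. Let $n=|C|/2$ and assume that $e_G(\{x,y\},V(C))>n$. Then for each $i$ with $1\le i\le n$, the induced subgraph $G[V(P)\cup V(C)]$ contains an $M$-cycle of length $|P|+2i$.
   Context: Graphs are finite and simple. For a matching $M$, an $M$-cycle is a cycle $C$ with $|E(C)\cap M|=|C|/2$. An $M$-path $P[x,y]$ is a path with ends $x,y$ whose edges alternate between $M$ and non-$M$ edges and whose first and last edges belong to $M$. $|P|$ and $|C|$ denote numbers of vertices. For disjoint vertex sets $S,T$, $e_G(S,T)$ is the number of edges of $G$ between $S$ and $T$. -}

module Defs where

open import Data.Nat using (ℕ; zero; suc; _+_; _*_; _≤_)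
open import Data.Bool using (Bool; true; false; if_then_else_; not)
open import Data.Fin using (Fin)
open import Data.List using (List; []; _∷_; length)
open import Data.List.Relation.Unary.All using (All)
open import Data.List.Relation.Unary.Unique.Propositional using (Unique)
open import Data.Product using (_×_; _,_; Σ; ∃)
open import Data.Unit using (⊤)
open import Data.Empty using (⊥)
open import Relation.Binary.PropositionalEquality using (_≡_; _≢_)

record Graph (N : ℕ) : Set where
  field
    adj    : Fin N → Fin N → Bool
    sym    : ∀ u v → adj u v ≡ adj v u
    irrefl : ∀ v → adj v v ≡ false
open Graph public

Adj : ∀ {N} → Graph N → Fin N → Fin N → Set
Adj G u v = adj G u v ≡ true

Bipartite : ∀ {N} → Graph N → Set
Bipartite {N} G = Σ (Fin N → Bool) λ col → ∀ u v → Adj G u v → col u ≢ col v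

record Matching {N : ℕ} (G : Graph N) : Set where
  field
    inM      : Fin N → Fin N → Bool
    inM-sym  : ∀ u v → inM u v ≡ inM v u
    inM-edge : ∀ u v → inM u v ≡ true → Adj G u v
    inM-uniq : ∀ u v w → inM u v ≡ true → inM u w ≡ true → v ≡ w
open Matching public

module _ {N : ℕ} where
  Edge : Set
  Edge = Fin N × Fin N

  pathEdges : List (Fin N) → List Edge
  pathEdges (a ∷ b ∷ r) = (a , b) ∷ pathEdges (b ∷ r)
  pathEdges _ = []

  cycEdgesFrom : Fin N → List (Fin N) → List Edge
  cycEdgesFrom f [] = []
  cycEdgesFrom f (a ∷ []) = (a , f) ∷ []
  cycEdgesFrom f (a ∷ b ∷ r) = (a , b) ∷ cycEdgesFrom f (b ∷ r)

  cycEdges : List (Fin N) → List Edge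
  cycEdges [] = []
  cycEdges (v ∷ vs) = cycEdgesFrom v (v ∷ vs)

module _ {N : ℕ} (G : Graph N) where
  IsPath : List (Fin N) → Set
  IsPath P = Unique P × All (λ e → Adj G (Data.Product.proj₁ e) (Data.Product.proj₂ e)) (pathEdges P)

  -- a cycle of G given by its cyclic vertex sequence (|C| = length)
  IsCycle : List (Fin N) → Set
  IsCycle C = Unique C × 3 ≤ length C
            × All (λ e → Adj G (Data.Product.proj₁ e) (Data.Product.proj₂ e)) (cycEdges C)

  degInto : Fin N → List (Fin N) → ℕ
  degInto x [] = 0
  degInto x (c ∷ cs) = (if adj G x c then 1 else 0) + degInto x cs

  module _ (M : Matching G) where
    countM : List Edge → ℕ
    countM [] = 0
    countM ((u , v) ∷ es) = (if inM M u v then 1 else 0) + countM es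

    AltFrom : Bool → List Edge → Set
    AltFrom b [] = ⊤
    AltFrom b ((u , v) ∷ es) = inM M u v ≡ b × AltFrom (not b) es

    FirstInM : List Edge → Set
    FirstInM [] = ⊥
    FirstInM ((u , v) ∷ _) = inM M u v ≡ true

    LastInM : List Edge → Set
    LastInM [] = ⊥
    LastInM ((u , v) ∷ []) = inM M u v ≡ true
    LastInM (_ ∷ e ∷ es) = LastInM (e ∷ es)

    IsMCycle : List (Fin N) → Set
    IsMCycle C = IsCycle C × 2 * countM (cycEdges C) ≡ length C

    IsMPath : List (Fin N) → Set
    IsMPath P = IsPath P × AltFrom true (pathEdges P)
              × FirstInM (pathEdges P) × LastInM (pathEdges P)

-- Walk around C as w₀ w₁ … (indices mod 2n) so that the M-edges of C are exactly the edges w_{2j} w_{2j+1};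
-- this is possible because n of its 2n edges lie in M and no two consecutive ones do.  Since G is bipartite
-- and the M-path P has an odd number of edges, its ends x and y get different colours, so one end has all its
-- neighbours on C at even positions and the other at odd positions.  Say y is the even one.  The degree
-- hypothesis then reads n < Σ_j [y ~ w_{2j}] + Σ_j [x ~ w_{2j+2i-1}] (the second sum shifted round the cycle),
-- and the pigeonhole principle yields j with y ~ w_{2j} and x ~ w_{2j+2i-1}.  The segment w_{2j} … w_{2j+2i-1}
-- is an M-path on 2i vertices disjoint from P, and P followed by it closes up into an M-cycle of length
-- |P| + 2i.  When x is the even end, the roles of x and y swap and the segment is traversed backwards.
module Submission where

open import Defs hiding (sym)
open import Data.Bool using (Bool; true; false; if_then_else_; not) renaming (_≟_ to _≟ᵇ_)
open import Data.Bool.Properties using (not-involutive; ¬-not; if-float)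
open import Data.Empty using (⊥; ⊥-elim)
open import Data.Fin using (Fin)
open import Data.List using (List; []; _∷_; _∷ʳ_; _++_; length; applyUpTo)
open import Data.List.Properties using (length-++; length-applyUpTo; applyUpTo-∷ʳ)
open import Data.List.Membership.Propositional using (_∈_; _∉_)
open import Data.List.Membership.Propositional.Properties using (∈-++⁺ˡ; ∈-++⁺ʳ)
open import Data.List.Relation.Binary.Disjoint.Propositional using (Disjoint)
open import Data.List.Relation.Unary.All as All using (All; []; _∷_; lookup; tabulate)
import Data.List.Relation.Unary.All.Properties as Allₚ
open import Data.List.Relation.Unary.AllPairs using (_∷_)
open import Data.List.Relation.Unary.Any using (here; there)
open import Data.List.Relation.Unary.Unique.Propositional using (Unique)
import Data.List.Relation.Unary.Unique.Propositional.Properties as Uniqueₚ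
open import Data.Nat using (ℕ; zero; suc; _+_; _*_; _∸_; _≤_; _<_; z≤n; s≤s; z<s; s<s; _%_; _/_; NonZero)
open import Data.Nat.Properties
open import Data.Nat.DivMod using (m*n/n≡m; m≡m%n+[m/n]*n; m%n<n; m<n⇒m%n≡m; [m+n]%n≡m%n; %-distribˡ-+)
open import Algebra.Properties.CommutativeSemigroup +-commutativeSemigroup using (interchange)
open import Data.Product using (Σ; _×_; _,_; proj₁; proj₂; ∃-syntax; map)
open import Data.Unit using (tt)
open import Function using (_∘_; id)
open import Relation.Binary.PropositionalEquality
open import Relation.Nullary using (Dec; yes; no)

𝟙 : Bool → ℕ
𝟙 b = if b then 1 else 0

sumTo : ℕ → (ℕ → ℕ) → ℕ
sumTo zero    f = 0
sumTo (suc n) f = f 0 + sumTo n (f ∘ suc)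

syntax sumTo n (λ k → e) = ∑[ k < n ] e

sumTo-cong : ∀ n {f g : ℕ → ℕ} → (∀ {k} → k < n → f k ≡ g k) → sumTo n f ≡ sumTo n g
sumTo-cong zero    eq = refl
sumTo-cong (suc n) eq = cong₂ _+_ (eq z<s) (sumTo-cong n (λ k<n → eq (s<s k<n)))

sumTo-+ : ∀ n (f g : ℕ → ℕ) → ∑[ k < n ] (f k + g k) ≡ sumTo n f + sumTo n g
sumTo-+ zero    f g = refl
sumTo-+ (suc n) f g =
  trans (cong (f 0 + g 0 +_) (sumTo-+ n (f ∘ suc) (g ∘ suc))) (interchange (f 0) (g 0) _ _)

sumTo-sucʳ : ∀ n (f : ℕ → ℕ) → sumTo (suc n) f ≡ sumTo n f + f n
sumTo-sucʳ zero    f = +-comm (f 0) 0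
sumTo-sucʳ (suc n) f = trans (cong (f 0 +_) (sumTo-sucʳ n (f ∘ suc))) (sym (+-assoc (f 0) _ _))

sumTo-rotate : ∀ n (h : ℕ → ℕ) → (∀ k → h (k + n) ≡ h k) → ∀ t → ∑[ j < n ] h (t + j) ≡ sumTo n h
sumTo-rotate n h periodic zero    = refl
sumTo-rotate n h periodic (suc t) = trans (+-cancelˡ-≡ (h t) _ _ step) (sumTo-rotate n h periodic t)
  where
    open ≡-Reasoning
    step : h t + ∑[ j < n ] h (suc t + j) ≡ h t + ∑[ j < n ] h (t + j)
    step = begin
      h t + ∑[ j < n ] h (suc t + j)      ≡⟨ cong₂ _+_ (cong h (sym (+-identityʳ t)))
                                                        (sumTo-cong n (λ {j} _ → cong h (sym (+-suc t j)))) ⟩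
      sumTo (suc n) (λ j → h (t + j))     ≡⟨ sumTo-sucʳ n (λ j → h (t + j)) ⟩
      ∑[ j < n ] h (t + j) + h (t + n)    ≡⟨ cong (∑[ j < n ] h (t + j) +_) (periodic t) ⟩
      ∑[ j < n ] h (t + j) + h t          ≡⟨ +-comm _ (h t) ⟩
      h t + ∑[ j < n ] h (t + j)          ∎

sumTo-pairs : ∀ n (f : ℕ → ℕ) → sumTo (2 * n) f ≡ ∑[ j < n ] (f (2 * j) + f (suc (2 * j)))
sumTo-pairs zero    f = refl
sumTo-pairs (suc n) f = begin
  sumTo (2 * suc n) f                                          ≡⟨ cong (λ m → sumTo m f) (*-suc 2 n) ⟩
  f 0 + (f 1 + sumTo (2 * n) (f ∘ suc ∘ suc))                  ≡⟨ sym (+-assoc (f 0) (f 1) _) ⟩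
  f 0 + f 1 + sumTo (2 * n) (f ∘ suc ∘ suc)                    ≡⟨ cong (f 0 + f 1 +_) (sumTo-pairs n (f ∘ suc ∘ suc)) ⟩
  f 0 + f 1 + ∑[ j < n ] (f (2 + 2 * j) + f (3 + 2 * j))       ≡⟨ cong (f 0 + f 1 +_) (sumTo-cong n (λ {j} _ →
                                                                    cong₂ (λ a b → f a + f b) (sym (*-suc 2 j))
                                                                          (cong suc (sym (*-suc 2 j))))) ⟩
  f 0 + f 1 + ∑[ j < n ] (f (2 * suc j) + f (suc (2 * suc j))) ∎
  where open ≡-Reasoning

sumTo-≤ : ∀ n (f : ℕ → ℕ) → (∀ k → f k ≤ 1) → sumTo n f ≤ n
sumTo-≤ zero    f f≤1 = z≤n
sumTo-≤ (suc n) f f≤1 = +-mono-≤ (f≤1 0) (sumTo-≤ n (f ∘ suc) (f≤1 ∘ suc))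

sumTo≡n⇒≡1 : ∀ n (f : ℕ → ℕ) → (∀ k → f k ≤ 1) → sumTo n f ≡ n → ∀ {k} → k < n → f k ≡ 1
sumTo≡n⇒≡1 (suc n) f f≤1 total = full
  where
    split : ∀ {a b} → a ≤ 1 → b ≤ n → a + b ≡ suc n → a ≡ 1 × b ≡ n
    split {zero}        _        b≤n b≡1+n = ⊥-elim (1+n≰n (subst (_≤ n) b≡1+n b≤n))
    split {suc zero}    _        _   eq    = refl , suc-injective eq
    split {suc (suc a)} (s≤s ()) _   _
    tight : f 0 ≡ 1 × sumTo n (f ∘ suc) ≡ n
    tight = split (f≤1 0) (sumTo-≤ n (f ∘ suc) (f≤1 ∘ suc)) total
    full : ∀ {k} → k < suc n → f k ≡ 1
    full {zero}  _         = proj₁ tight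
    full {suc k} (s<s k<n) = sumTo≡n⇒≡1 n (f ∘ suc) (f≤1 ∘ suc) (proj₂ tight) k<n

pigeonhole : ∀ n (f g : ℕ → Bool) → n < ∑[ j < n ] 𝟙 (f j) + ∑[ j < n ] 𝟙 (g j) →
             ∃[ j ] f j ≡ true × g j ≡ true
pigeonhole zero    f g ()
pigeonhole (suc n) f g 1+n<sum with f 0 in f0 | g 0 in g0
... | true  | true  = 0 , f0 , g0
... | true  | false = map suc id (pigeonhole n (f ∘ suc) (g ∘ suc) (≤-pred 1+n<sum))
... | false | true  = map suc id (pigeonhole n (f ∘ suc) (g ∘ suc)
                                   (≤-pred (subst (suc n <_) (+-suc _ _) 1+n<sum)))
... | false | false = map suc id (pigeonhole n (f ∘ suc) (g ∘ suc) (<-trans (n<1+n n) 1+n<sum))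

true≢false : true ≢ false
true≢false ()

isEven : ℕ → Bool
isEven zero    = true
isEven (suc k) = not (isEven k)

not-if : ∀ b (q : Bool) → not (if b then q else not q) ≡ (if not b then q else not q)
not-if true  q = refl
not-if false q = not-involutive q

if-≡-true : ∀ p q → (if p then q else not q) ≡ true → p ≡ q
if-≡-true true  true  _ = refl
if-≡-true false false _ = refl

alternating-parity : ∀ (g : ℕ → Bool) → (∀ k → g (suc k) ≡ not (g k)) →
                     ∀ k → g k ≡ (if isEven k then g 0 else not (g 0))
alternating-parity g step zero    = refl
alternating-parity g step (suc k) =
  trans (step k) (trans (cong not (alternating-parity g step k)) (not-if (isEven k) (g 0)))

alternating-≡-isEven : ∀ (g : ℕ → Bool) → g 0 ≡ true → (∀ k → g (suc k) ≡ not (g k)) →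
                       ∀ k → g k ≡ isEven k
alternating-≡-isEven g g0 step zero    = g0
alternating-≡-isEven g g0 step (suc k) = trans (step k) (cong not (alternating-≡-isEven g g0 step k))

isEven-+ : ∀ m n → isEven (m + n) ≡ (if isEven m then isEven n else not (isEven n))
isEven-+ m n = alternating-parity (λ k → isEven (k + n)) (λ _ → refl) m

isEven-even+ : ∀ m n → isEven m ≡ true → isEven (m + n) ≡ isEven n
isEven-even+ m n m-even =
  trans (isEven-+ m n) (cong (λ b → if b then isEven n else not (isEven n)) m-even)

isEven-∸ : ∀ {m} n → n ≤ m → isEven m ≡ true → isEven (m ∸ n) ≡ isEven n
isEven-∸ {m} n n≤m m-even =
  if-≡-true _ _ (trans (sym (isEven-+ (m ∸ n) n)) (trans (cong isEven (m∸n+n≡m n≤m)) m-even))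

isEven-2* : ∀ j → isEven (2 * j) ≡ true
isEven-2* zero    = refl
isEven-2* (suc j) = trans (cong isEven (*-suc 2 j)) (trans (not-involutive _) (isEven-2* j))

sumTo-evens : ∀ n (g : ℕ → Bool) → (∀ k → g k ≡ true → isEven k ≡ true) →
              ∑[ k < 2 * n ] 𝟙 (g k) ≡ ∑[ j < n ] 𝟙 (g (2 * j))
sumTo-evens n g onlyEven = trans (sumTo-pairs n (𝟙 ∘ g)) (sumTo-cong n (λ {j} _ →
  trans (cong (𝟙 (g (2 * j)) +_) (cong 𝟙 (odd-false j))) (+-identityʳ _)))
  where
    odd-false : ∀ j → g (suc (2 * j)) ≡ false
    odd-false j = ¬-not (λ odd-true → true≢false
                    (trans (sym (onlyEven _ odd-true)) (cong not (isEven-2* j))))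

sumTo-odds : ∀ n (g : ℕ → Bool) → (∀ k → g (k + 2 * n) ≡ g k) →
             (∀ k → g k ≡ true → isEven k ≡ false) →
             ∀ s → ∑[ k < 2 * n ] 𝟙 (g k) ≡ ∑[ j < n ] 𝟙 (g (2 * j + suc (2 * s)))
sumTo-odds n g periodic onlyOdd s = begin
  ∑[ k < 2 * n ] 𝟙 (g k)                            ≡⟨ sumTo-pairs n (𝟙 ∘ g) ⟩
  ∑[ j < n ] (𝟙 (g (2 * j)) + 𝟙 (g (suc (2 * j))))   ≡⟨ sumTo-cong n (λ {j} _ → cong (_+ 𝟙 (g (suc (2 * j))))
                                                                                  (cong 𝟙 (even-false j))) ⟩
  ∑[ j < n ] 𝟙 (g (suc (2 * j)))                    ≡⟨ sym (sumTo-rotate n (λ j → 𝟙 (g (suc (2 * j)))) h-periodic s) ⟩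
  ∑[ j < n ] 𝟙 (g (suc (2 * (s + j))))              ≡⟨ sumTo-cong n (λ {j} _ → cong (𝟙 ∘ g) (reindex j)) ⟩
  ∑[ j < n ] 𝟙 (g (2 * j + suc (2 * s)))            ∎
  where
    open ≡-Reasoning
    even-false : ∀ j → g (2 * j) ≡ false
    even-false j = ¬-not (λ even-true → true≢false (trans (sym (isEven-2* j)) (onlyOdd _ even-true)))
    h-periodic : ∀ k → 𝟙 (g (suc (2 * (k + n)))) ≡ 𝟙 (g (suc (2 * k)))
    h-periodic k = cong 𝟙 (trans (cong (g ∘ suc) (*-distribˡ-+ 2 k n)) (periodic (suc (2 * k))))
    reindex : ∀ j → suc (2 * (s + j)) ≡ 2 * j + suc (2 * s)
    reindex j = trans (cong suc (trans (*-distribˡ-+ 2 s j) (+-comm (2 * s) (2 * j))))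
                      (sym (+-suc (2 * j) (2 * s)))

periodicInduction : ∀ L .{{_ : NonZero L}} (P : ℕ → Set) → (∀ {k} → k < L → P k) →
                    (∀ k → P k → P (k + L)) → ∀ k → P k
periodicInduction L P base step k = subst P (sym (m≡m%n+[m/n]*n k L)) (shifted (k / L))
  where
    shifted : ∀ q → P (k % L + q * L)
    shifted zero    = subst P (sym (+-identityʳ _)) (base (m%n<n k L))
    shifted (suc q) = subst P (trans (+-assoc (k % L) (q * L) L) (cong (k % L +_) (+-comm (q * L) L)))
                              (step _ (shifted q))

[m+n]%d≡m⇒n≡0 : ∀ d .{{_ : NonZero d}} m n → m < d → n < d → (m + n) % d ≡ m → n ≡ 0
[m+n]%d≡m⇒n≡0 d m n m<d n<d eq with m + n <? d
... | yes m+n<d = +-cancelˡ-≡ m n 0 (trans (sym (m<n⇒m%n≡m m+n<d)) (trans eq (sym (+-identityʳ m))))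
... | no  m+n≮d = ⊥-elim (<-irrefl (sym d≡n) n<d)
  where
    w : ℕ
    w = m + n ∸ d
    w+d≡m+n : w + d ≡ m + n
    w+d≡m+n = m∸n+n≡m (≮⇒≥ m+n≮d)
    w<d : w < d
    w<d = +-cancelʳ-< d w d (subst (_< d + d) (sym w+d≡m+n) (+-mono-< m<d n<d))
    m≡w : m ≡ w
    m≡w = trans (sym eq) (trans (cong (_% d) (sym w+d≡m+n)) (trans ([m+n]%n≡m%n w d) (m<n⇒m%n≡m w<d)))
    d≡n : d ≡ n
    d≡n = +-cancelˡ-≡ m d n (trans (cong (_+ d) m≡w) w+d≡m+n)

-- Consecutive pairs sum to at most 1, and by periodicity their total is twice the number of trues, i.e. L;
-- so every pair sums to exactly 1.
alternates : ∀ L .{{_ : NonZero L}} (f : ℕ → Bool) → (∀ k → f (k + L) ≡ f k) →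
             (∀ k → f k ≡ true → f (suc k) ≡ true → ⊥) → 2 * ∑[ k < L ] 𝟙 (f k) ≡ L →
             ∀ k → f (suc k) ≡ not (f k)
alternates L f periodic isolated balanced =
  periodicInduction L (λ k → f (suc k) ≡ not (f k))
    (λ k<L → exactlyOne (sumTo≡n⇒≡1 L pairSum pairSum≤1 total k<L))
    (λ k eq → trans (periodic (suc k)) (trans eq (cong not (sym (periodic k)))))
  where
    pairSum : ℕ → ℕ
    pairSum k = 𝟙 (f k) + 𝟙 (f (suc k))
    pairSum≤1 : ∀ k → pairSum k ≤ 1
    pairSum≤1 k with f k in fk | f (suc k) in fsk
    ... | true  | true  = ⊥-elim (isolated k fk fsk)
    ... | true  | false = ≤-refl
    ... | false | true  = ≤-refl
    ... | false | false = z≤n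
    Σf : ℕ
    Σf = ∑[ k < L ] 𝟙 (f k)
    total : sumTo L pairSum ≡ L
    total = begin
      sumTo L pairSum                                  ≡⟨ sumTo-+ L (𝟙 ∘ f) (𝟙 ∘ f ∘ suc) ⟩
      Σf + ∑[ k < L ] 𝟙 (f (suc k))                    ≡⟨ cong (Σf +_) (sumTo-rotate L (𝟙 ∘ f) (cong 𝟙 ∘ periodic) 1) ⟩
      Σf + Σf                                          ≡⟨ cong (Σf +_) (sym (+-identityʳ Σf)) ⟩
      2 * Σf                                           ≡⟨ balanced ⟩
      L                                                ∎
      where open ≡-Reasoning
    exactlyOne : ∀ {a b} → 𝟙 a + 𝟙 b ≡ 1 → b ≡ not a
    exactlyOne {true}  {false} _ = refl
    exactlyOne {false} {true}  _ = refl

module _ {A : Set} where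

  lastOf : A → List A → A
  lastOf a []      = a
  lastOf a (b ∷ r) = lastOf b r

  lastOf-++ : ∀ a r s → lastOf a (r ++ s) ≡ lastOf (lastOf a r) s
  lastOf-++ a []      s = refl
  lastOf-++ a (b ∷ r) s = lastOf-++ b r s

  lastOf-applyUpTo : ∀ (e : ℕ → A) m → lastOf (e 0) (applyUpTo (e ∘ suc) m) ≡ e m
  lastOf-applyUpTo e zero    = refl
  lastOf-applyUpTo e (suc m) = lastOf-applyUpTo (e ∘ suc) m

  applyUpTo-cong : ∀ n {f g : ℕ → A} → (∀ {k} → k < n → f k ≡ g k) → applyUpTo f n ≡ applyUpTo g n
  applyUpTo-cong zero    eq = refl
  applyUpTo-cong (suc n) eq = cong₂ _∷_ (eq z<s) (applyUpTo-cong n (λ k<n → eq (s<s k<n)))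

  nth : A → List A → ℕ → A
  nth d []      k       = d
  nth d (a ∷ l) zero    = a
  nth d (a ∷ l) (suc k) = nth d l k

  nth-∈ : ∀ d l {k} → k < length l → nth d l k ∈ l
  nth-∈ d (a ∷ l) {zero}  _         = here refl
  nth-∈ d (a ∷ l) {suc k} (s<s k<l) = there (nth-∈ d l k<l)

  nth-injective : ∀ d {l} → Unique l → ∀ {j k} → j < length l → k < length l →
                  nth d l j ≡ nth d l k → j ≡ k
  nth-injective d {a ∷ l} _            {zero}  {zero}  _         _         _  = refl
  nth-injective d {a ∷ l} (a∉l ∷ _)    {zero}  {suc k} _         (s<s k<l) eq =
    ⊥-elim (lookup a∉l (nth-∈ d l k<l) eq)
  nth-injective d {a ∷ l} (a∉l ∷ _)    {suc j} {zero}  (s<s j<l) _         eq =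
    ⊥-elim (lookup a∉l (nth-∈ d l j<l) (sym eq))
  nth-injective d {a ∷ l} (_ ∷ unique) {suc j} {suc k} (s<s j<l) (s<s k<l) eq =
    cong suc (nth-injective d unique j<l k<l eq)

  applyUpTo-nth : ∀ d l → applyUpTo (nth d l) (length l) ≡ l
  applyUpTo-nth d []      = refl
  applyUpTo-nth d (a ∷ l) = cong (a ∷_) (applyUpTo-nth d l)

module _ {N : ℕ} where

  pathEdges-++ : ∀ (a : Fin N) r b s →
                 pathEdges ((a ∷ r) ++ (b ∷ s)) ≡ pathEdges (a ∷ r) ++ (lastOf a r , b) ∷ pathEdges (b ∷ s)
  pathEdges-++ a []      b s = refl
  pathEdges-++ a (c ∷ r) b s = cong ((a , c) ∷_) (pathEdges-++ c r b s)

  length-pathEdges : ∀ (a : Fin N) r → length (pathEdges (a ∷ r)) ≡ length r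
  length-pathEdges a []      = refl
  length-pathEdges a (b ∷ r) = cong suc (length-pathEdges b r)

  cycEdgesFrom-pathEdges : ∀ (f a : Fin N) r → cycEdgesFrom f (a ∷ r) ≡ pathEdges (a ∷ r) ∷ʳ (lastOf a r , f)
  cycEdgesFrom-pathEdges f a []      = refl
  cycEdgesFrom-pathEdges f a (b ∷ r) = cong ((a , b) ∷_) (cycEdgesFrom-pathEdges f b r)

  cycEdges-++ : ∀ (a : Fin N) r b s → cycEdges ((a ∷ r) ++ (b ∷ s)) ≡
                (pathEdges (a ∷ r) ++ (lastOf a r , b) ∷ pathEdges (b ∷ s)) ∷ʳ (lastOf b s , a)
  cycEdges-++ a r b s = trans (cycEdgesFrom-pathEdges a a (r ++ b ∷ s))
    (cong₂ (λ es ℓ → es ∷ʳ (ℓ , a)) (pathEdges-++ a r b s) (lastOf-++ a r (b ∷ s)))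

  pathEdges-applyUpTo : ∀ (e : ℕ → Fin N) m →
                        pathEdges (applyUpTo e (suc m)) ≡ applyUpTo (λ t → e t , e (suc t)) m
  pathEdges-applyUpTo e zero    = refl
  pathEdges-applyUpTo e (suc m) = cong ((e 0 , e 1) ∷_) (pathEdges-applyUpTo (e ∘ suc) m)

  cycEdges-applyUpTo : ∀ (e : ℕ → Fin N) m →
                       cycEdges (applyUpTo e (suc m)) ≡ applyUpTo (λ t → e t , e (suc t)) m ∷ʳ (e m , e 0)
  cycEdges-applyUpTo e m = trans (cycEdgesFrom-pathEdges (e 0) (e 0) (applyUpTo (e ∘ suc) m))
    (cong₂ (λ es ℓ → es ∷ʳ (ℓ , e 0)) (pathEdges-applyUpTo e m) (lastOf-applyUpTo e m))

-- M-paths and M-cycles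

module _ {N : ℕ} (G : Graph N) where

  IsEdge : Fin N × Fin N → Set
  IsEdge (u , v) = Adj G u v

  Adj-sym : ∀ {u v} → Adj G u v → Adj G v u
  Adj-sym {u} {v} uv = trans (Graph.sym G v u) uv

  degInto-applyUpTo : ∀ z (e : ℕ → Fin N) m → degInto G z (applyUpTo e m) ≡ ∑[ k < m ] 𝟙 (adj G z (e k))
  degInto-applyUpTo z e zero    = refl
  degInto-applyUpTo z e (suc m) = cong (𝟙 (adj G z (e 0)) +_) (degInto-applyUpTo z (e ∘ suc) m)

  module _ (M : Matching G) where

    countM-applyUpTo : ∀ (g : ℕ → Fin N × Fin N) m →
                       countM G M (applyUpTo g m) ≡ ∑[ t < m ] 𝟙 (inM M (proj₁ (g t)) (proj₂ (g t)))
    countM-applyUpTo g zero    = refl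
    countM-applyUpTo g (suc m) = cong (𝟙 (inM M (proj₁ (g 0)) (proj₂ (g 0))) +_) (countM-applyUpTo (g ∘ suc) m)

    countM-++-nonM : ∀ es u v fs → inM M u v ≡ false →
                     countM G M (es ++ (u , v) ∷ fs) ≡ countM G M es + countM G M fs
    countM-++-nonM []             u v fs uv∉M rewrite uv∉M = refl
    countM-++-nonM ((a , b) ∷ es) u v fs uv∉M =
      trans (cong (𝟙 (inM M a b) +_) (countM-++-nonM es u v fs uv∉M)) (sym (+-assoc (𝟙 (inM M a b)) _ _))

    AltFrom-countM : ∀ b es → AltFrom G M b es → LastInM G M es → 2 * countM G M es ≡ length es + 𝟙 b
    AltFrom-countM _ ((u , v) ∷ [])     (refl , _)   uv∈M rewrite uv∈M = refl
    AltFrom-countM _ ((u , v) ∷ e ∷ es) (refl , alt) last =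
      step (inM M u v) (AltFrom-countM (not (inM M u v)) (e ∷ es) alt last)
      where
        step : ∀ β {c L} → 2 * c ≡ L + 𝟙 (not β) → 2 * (𝟙 β + c) ≡ suc L + 𝟙 β
        step true  {c} {L} eq =
          trans (*-suc 2 c) (trans (cong (2 +_) (trans eq (+-identityʳ L))) (cong suc (+-comm 1 L)))
        step false {c} {L} eq = trans eq (trans (+-comm L 1) (sym (+-identityʳ (suc L))))

    MPath-balanced : ∀ {a r} → IsMPath G M (a ∷ r) → 2 * countM G M (pathEdges (a ∷ r)) ≡ length (a ∷ r)
    MPath-balanced {a} {r} (_ , alt , _ , last) = trans (AltFrom-countM true (pathEdges (a ∷ r)) alt last)
                                                        (trans (cong (_+ 1) (length-pathEdges a r)) (+-comm _ 1))

    LastInM-partner : ∀ a r {z} → LastInM G M (pathEdges (a ∷ r)) → inM M (lastOf a r) z ≡ true → z ∈ a ∷ r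
    LastInM-partner a (b ∷ [])    last bz∈M = here (inM-uniq M b _ a bz∈M (trans (inM-sym M b a) last))
    LastInM-partner a (b ∷ c ∷ r) last z∈M  = there (LastInM-partner b (c ∷ r) last z∈M)

    MPath-2≤length : ∀ {P} → IsMPath G M P → 2 ≤ length P
    MPath-2≤length {_ ∷ _ ∷ _} _ = s≤s (s≤s z≤n)
    MPath-2≤length {_ ∷ []} (_ , _ , () , _)

    joinMPaths : ∀ {a r b s} → IsMPath G M (a ∷ r) → IsMPath G M (b ∷ s) → Disjoint (a ∷ r) (b ∷ s) →
                 Adj G (lastOf a r) b → Adj G (lastOf b s) a → IsMCycle G M ((a ∷ r) ++ (b ∷ s))
    joinMPaths {a} {r} {b} {s} pP@((uP , adjP) , _ , _ , lastP) pS@((uS , adjS) , _ , _ , lastS) disjoint ab ba =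
      (Uniqueₚ.++⁺ uP uS disjoint , three
      , subst (All IsEdge) (sym edges) (Allₚ.++⁺ (Allₚ.++⁺ adjP (ab ∷ adjS)) (ba ∷ [])))
      , balanced
      where
        P S : List (Fin N)
        P = a ∷ r
        S = b ∷ s
        middle : List (Fin N × Fin N)
        middle = pathEdges P ++ (lastOf a r , b) ∷ pathEdges S
        edges : cycEdges (P ++ S) ≡ middle ∷ʳ (lastOf b s , a)
        edges = cycEdges-++ a r b s
        three : 3 ≤ length (P ++ S)
        three = subst (3 ≤_) (sym (length-++ P))
                      (≤-trans (s≤s (s≤s (s≤s z≤n))) (+-mono-≤ (MPath-2≤length pP) (MPath-2≤length pS)))
        ab∉M : inM M (lastOf a r) b ≡ false
        ab∉M = ¬-not (λ ab∈M → disjoint (LastInM-partner a r lastP ab∈M , here refl))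
        ba∉M : inM M (lastOf b s) a ≡ false
        ba∉M = ¬-not (λ ba∈M → disjoint (here refl , LastInM-partner b s lastS ba∈M))
        cP cS : ℕ
        cP = countM G M (pathEdges P)
        cS = countM G M (pathEdges S)
        open ≡-Reasoning
        balanced : 2 * countM G M (cycEdges (P ++ S)) ≡ length (P ++ S)
        balanced = begin
          2 * countM G M (cycEdges (P ++ S))                 ≡⟨ cong (λ es → 2 * countM G M es) edges ⟩
          2 * countM G M (middle ++ (lastOf b s , a) ∷ [])   ≡⟨ cong (2 *_) (countM-++-nonM middle _ _ [] ba∉M) ⟩
          2 * (countM G M middle + 0)                        ≡⟨ cong (λ c → 2 * (c + 0))
                                                                     (countM-++-nonM (pathEdges P) _ _ _ ab∉M) ⟩
          2 * (cP + cS + 0)                                  ≡⟨ cong (2 *_) (+-identityʳ (cP + cS)) ⟩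
          2 * (cP + cS)                                      ≡⟨ *-distribˡ-+ 2 cP cS ⟩
          2 * cP + 2 * cS                                    ≡⟨ cong₂ _+_ (MPath-balanced pP) (MPath-balanced pS) ⟩
          length P + length S                                ≡⟨ sym (length-++ P) ⟩
          length (P ++ S)                                    ∎

    AltFrom-applyUpTo : ∀ (g : ℕ → Fin N × Fin N) (f : ℕ → Bool) m → (∀ t → f (suc t) ≡ not (f t)) →
                        (∀ {t} → t < m → inM M (proj₁ (g t)) (proj₂ (g t)) ≡ f t) →
                        AltFrom G M (f 0) (applyUpTo g m)
    AltFrom-applyUpTo g f zero    step alt = tt
    AltFrom-applyUpTo g f (suc m) step alt =
      alt z<s , subst (λ b → AltFrom G M b (applyUpTo (g ∘ suc) m)) (step 0)
                      (AltFrom-applyUpTo (g ∘ suc) (f ∘ suc) m (step ∘ suc) (λ t<m → alt (s<s t<m)))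

    LastInM-applyUpTo : ∀ (g : ℕ → Fin N × Fin N) m → inM M (proj₁ (g m)) (proj₂ (g m)) ≡ true →
                        LastInM G M (applyUpTo g (suc m))
    LastInM-applyUpTo g zero    gm∈M = gm∈M
    LastInM-applyUpTo g (suc m) gm∈M = LastInM-applyUpTo (g ∘ suc) m gm∈M

    applyUpTo-MPath : ∀ (e : ℕ → Fin N) m →
                      (∀ {t} → t < suc (2 * m) → Adj G (e t) (e (suc t))) →
                      (∀ {t} → t < suc (2 * m) → inM M (e t) (e (suc t)) ≡ isEven t) →
                      (∀ {t t'} → t < t' → t' < 2 + 2 * m → e t ≢ e t') →
                      IsMPath G M (applyUpTo e (2 + 2 * m))
    applyUpTo-MPath e m adjacent alternating injective =
      (Uniqueₚ.applyUpTo⁺₁ e (2 + 2 * m) injective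
      , subst (All IsEdge) (sym edges) (Allₚ.applyUpTo⁺₁ step _ adjacent))
      , subst (AltFrom G M true) (sym edges) (AltFrom-applyUpTo step isEven _ (λ _ → refl) alternating)
      , alternating z<s
      , subst (LastInM G M) (sym edges) (LastInM-applyUpTo step (2 * m) (trans (alternating ≤-refl) (isEven-2* m)))
      where
        step : ℕ → Fin N × Fin N
        step t = e t , e (suc t)
        edges : pathEdges (applyUpTo e (2 + 2 * m)) ≡ applyUpTo step (suc (2 * m))
        edges = pathEdges-applyUpTo e (suc (2 * m))

    CycleThrough : List (Fin N) → List (Fin N) → ℕ → Set
    CycleThrough P C ℓ = Σ (List (Fin N)) λ D → IsMCycle G M D × All (_∈ P ++ C) D × length D ≡ ℓ

    spliceSegment : ∀ {C x r a s} → IsMPath G M (x ∷ r) → All (_∉ C) (x ∷ r) →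
                    IsMPath G M (a ∷ s) → All (_∈ C) (a ∷ s) → Adj G (lastOf x r) a → Adj G (lastOf a s) x →
                    CycleThrough (x ∷ r) C (length (x ∷ r) + length (a ∷ s))
    spliceSegment {x = x} {r} P-path P∉C S-path S⊆C ya ℓx =
      (x ∷ r) ++ _ , joinMPaths P-path S-path disjoint ya ℓx
      , Allₚ.++⁺ {xs = x ∷ r} (tabulate ∈-++⁺ˡ) (All.map (∈-++⁺ʳ (x ∷ r)) S⊆C) , length-++ (x ∷ r)
      where
        disjoint : Disjoint (x ∷ r) _
        disjoint (v∈P , v∈S) = lookup P∉C v∈P (lookup S⊆C v∈S)

    -- Traversing an M-cycle

    record AlternatingTraversal (C : List (Fin N)) (n : ℕ) : Set where
      field
        walk        : ℕ → Fin N
        adjacent    : ∀ k → Adj G (walk k) (walk (suc k))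
        alternating : ∀ k → inM M (walk k) (walk (suc k)) ≡ isEven k
        periodic    : ∀ k → walk (k + 2 * n) ≡ walk k
        injective   : ∀ {u δ} → walk u ≡ walk (u + δ) → δ < 2 * n → δ ≡ 0
        onCycle     : ∀ k → walk k ∈ C
        degree      : ∀ z → degInto G z C ≡ ∑[ k < 2 * n ] 𝟙 (adj G z (walk k))

    module CyclicOrder (v : Fin N) (vs : List (Fin N)) where

      L : ℕ
      L = length (v ∷ vs)

      cyc : ℕ → Fin N
      cyc k = nth v (v ∷ vs) (k % L)

      cycEdge : ℕ → Fin N × Fin N
      cycEdge k = cyc k , cyc (suc k)

      cyc-periodic : ∀ k → cyc (k + L) ≡ cyc k
      cyc-periodic k = cong (nth v (v ∷ vs)) ([m+n]%n≡m%n k L)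

      cyc-∈ : ∀ k → cyc k ∈ v ∷ vs
      cyc-∈ k = nth-∈ v (v ∷ vs) (m%n<n k L)

      applyUpTo-cyc : applyUpTo cyc L ≡ v ∷ vs
      applyUpTo-cyc = trans (applyUpTo-cong L (λ k<L → cong (nth v (v ∷ vs)) (m<n⇒m%n≡m k<L)))
                            (applyUpTo-nth v (v ∷ vs))

      cycEdges-cyc : cycEdges (v ∷ vs) ≡ applyUpTo cycEdge L
      cycEdges-cyc = begin
        cycEdges (v ∷ vs)                                           ≡⟨ cong cycEdges (sym applyUpTo-cyc) ⟩
        cycEdges (applyUpTo cyc L)                                  ≡⟨ cycEdges-applyUpTo cyc (length vs) ⟩
        applyUpTo cycEdge (length vs) ∷ʳ (cyc (length vs) , cyc 0)  ≡⟨ cong (λ w → applyUpTo cycEdge (length vs)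
                                                                                   ∷ʳ (cyc (length vs) , w))
                                                                            (sym (cyc-periodic 0)) ⟩
        applyUpTo cycEdge (length vs) ∷ʳ cycEdge (length vs)        ≡⟨ applyUpTo-∷ʳ cycEdge (length vs) ⟩
        applyUpTo cycEdge L                                         ∎
        where open ≡-Reasoning

      cyc-edge : ∀ {Q : Fin N × Fin N → Set} → All Q (cycEdges (v ∷ vs)) → ∀ k → Q (cycEdge k)
      cyc-edge {Q} all = periodicInduction L (Q ∘ cycEdge)
        (Allₚ.applyUpTo⁻ cycEdge L (subst (All Q) cycEdges-cyc all))
        (λ k → subst₂ (λ a b → Q (a , b)) (sym (cyc-periodic k)) (sym (cyc-periodic (suc k))))

      cyc-injective : Unique (v ∷ vs) → ∀ {u δ} → cyc u ≡ cyc (u + δ) → δ < L → δ ≡ 0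
      cyc-injective unique {u} {δ} eq δ<L = [m+n]%d≡m⇒n≡0 L (u % L) δ (m%n<n u L) δ<L (sym (begin
        u % L                  ≡⟨ nth-injective v unique (m%n<n u L) (m%n<n (u + δ) L) eq ⟩
        (u + δ) % L            ≡⟨ %-distribˡ-+ u δ L ⟩
        (u % L + δ % L) % L    ≡⟨ cong (λ r → (u % L + r) % L) (m<n⇒m%n≡m δ<L) ⟩
        (u % L + δ) % L        ∎))
        where open ≡-Reasoning

      cyc-degree : ∀ z → degInto G z (v ∷ vs) ≡ ∑[ k < L ] 𝟙 (adj G z (cyc k))
      cyc-degree z = trans (cong (degInto G z) (sym applyUpTo-cyc)) (degInto-applyUpTo z cyc L)

      cyc-countM : countM G M (cycEdges (v ∷ vs)) ≡ ∑[ k < L ] 𝟙 (inM M (cyc k) (cyc (suc k)))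
      cyc-countM = trans (cong (countM G M) cycEdges-cyc) (countM-applyUpTo cycEdge L)

    MCycle-traversal : ∀ {C} → IsMCycle G M C → AlternatingTraversal C (countM G M (cycEdges C))
    MCycle-traversal {v ∷ vs} ((unique , 3≤L , adjacentC) , balanced) = record
      { walk        = walk
      ; adjacent    = λ k → subst (Adj G (walk k)) (sym (walk-suc k)) (cyc-edge adjacentC (p + k))
      ; alternating = λ k → trans (cong (inM M (walk k)) (walk-suc k)) (μ-from-p k)
      ; periodic    = λ k → trans (cong cyc (trans (sym (+-assoc p k (2 * n))) (cong (p + k +_) balanced)))
                                  (cyc-periodic (p + k))
      ; injective   = λ {u} {δ} eq δ<2n → cyc-injective unique {p + u} {δ}
                          (trans eq (cong cyc (sym (+-assoc p u δ)))) (subst (δ <_) balanced δ<2n)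
      ; onCycle     = λ k → cyc-∈ (p + k)
      ; degree      = λ z → trans (cyc-degree z) (trans
                          (sym (sumTo-rotate L (𝟙 ∘ adj G z ∘ cyc) (cong (𝟙 ∘ adj G z) ∘ cyc-periodic) p))
                          (cong (λ m → ∑[ k < m ] 𝟙 (adj G z (walk k))) (sym balanced)))
      }
      where
        open CyclicOrder v vs
        n : ℕ
        n = countM G M (cycEdges (v ∷ vs))
        μ : ℕ → Bool
        μ k = inM M (cyc k) (cyc (suc k))
        isolated : ∀ k → μ k ≡ true → μ (suc k) ≡ true → ⊥
        isolated k μk μsk = 0≢1+n (sym (cyc-injective unique {k} {2} (trans
          (inM-uniq M (cyc (suc k)) (cyc k) (cyc (suc (suc k))) (trans (inM-sym M _ _) μk) μsk)
          (cong cyc (+-comm 2 k))) 3≤L))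
        μ-alternates : ∀ k → μ (suc k) ≡ not (μ k)
        μ-alternates = alternates L μ (λ k → cong₂ (inM M) (cyc-periodic k) (cyc-periodic (suc k))) isolated
                                  (trans (cong (2 *_) (sym cyc-countM)) balanced)
        start : ∃[ p ] μ p ≡ true
        start with μ 0 in μ0
        ... | true  = 0 , μ0
        ... | false = 1 , trans (μ-alternates 0) (cong not μ0)
        p : ℕ
        p = proj₁ start
        walk : ℕ → Fin N
        walk k = cyc (p + k)
        walk-suc : ∀ k → walk (suc k) ≡ cyc (suc (p + k))
        walk-suc k = cong cyc (+-suc p k)
        μ-from-p : ∀ k → μ (p + k) ≡ isEven k
        μ-from-p = alternating-≡-isEven (μ ∘ (p +_)) (trans (cong μ (+-identityʳ p)) (proj₂ start))
                                        (λ k → trans (cong μ (+-suc p k)) (μ-alternates (p + k)))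

    -- Bipartite graphs

    module _ (col : Fin N → Bool) (proper : ∀ u v → Adj G u v → col u ≢ col v) where

      colour-flips : ∀ {u v} → Adj G u v → col v ≡ not (col u)
      colour-flips {u} {v} uv = ¬-not (proper v u (Adj-sym uv))

      lastOf-colour : ∀ a r → All IsEdge (pathEdges (a ∷ r)) →
                      col (lastOf a r) ≡ (if isEven (length r) then col a else not (col a))
      lastOf-colour a []      _            = refl
      lastOf-colour a (b ∷ r) (ab ∷ edges) = begin
        col (lastOf b r)                                                ≡⟨ lastOf-colour b r edges ⟩
        (if isEven (length r) then col b else not (col b))              ≡⟨ cong (λ c → if isEven (length r) then c else not c)
                                                                                (colour-flips ab) ⟩
        (if isEven (length r) then not (col a) else not (not (col a)))  ≡⟨ sym (if-float not (isEven (length r))) ⟩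
        not (if isEven (length r) then col a else not (col a))          ≡⟨ not-if (isEven (length r)) (col a) ⟩
        (if not (isEven (length r)) then col a else not (col a))        ∎
        where open ≡-Reasoning

      MPath-endColour : ∀ {x r} → IsMPath G M (x ∷ r) → col (lastOf x r) ≡ not (col x)
      MPath-endColour {x} {r} P-path@((_ , edges) , _) =
        trans (lastOf-colour x r edges) (cong (λ b → if b then col x else not (col x)) r-odd)
        where
          r-odd : isEven (length r) ≡ false
          r-odd = ¬-not (λ r-even → true≢false (trans (sym (isEven-2* (countM G M (pathEdges (x ∷ r)))))
                                                      (trans (cong isEven (MPath-balanced P-path)) (cong not r-even))))

      module _ {C n} (T : AlternatingTraversal C n) where
        open AlternatingTraversal T

        walk-colour : ∀ k → col (walk k) ≡ (if isEven k then col (walk 0) else not (col (walk 0)))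
        walk-colour = alternating-parity (col ∘ walk) (λ k → colour-flips (adjacent k))

        oddNeighbour : ∀ {z k} → col z ≡ col (walk 0) → Adj G z (walk k) → isEven k ≡ false
        oddNeighbour {z} {k} z≡q zk with isEven k in k-parity
        ... | false = refl
        ... | true  = ⊥-elim (proper z (walk k) zk (trans z≡q (sym (trans (walk-colour k)
                        (cong (λ b → if b then col (walk 0) else not (col (walk 0))) k-parity)))))

        evenNeighbour : ∀ {z k} → col z ≡ not (col (walk 0)) → Adj G z (walk k) → isEven k ≡ true
        evenNeighbour {z} {k} z≡¬q zk with isEven k in k-parity
        ... | true  = refl
        ... | false = ⊥-elim (proper z (walk k) zk (trans z≡¬q (sym (trans (walk-colour k)
                        (cong (λ b → if b then col (walk 0) else not (col (walk 0))) k-parity)))))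

        -- u sees only odd positions and w only even ones; rotating the sum over u's neighbours by m lets the
        -- pigeonhole principle pair position 2j with position 2j + 2m + 1.
        oppositeNeighbours : ∀ {u w} → col u ≡ col (walk 0) → col w ≡ not (col (walk 0)) →
                             n < degInto G u C + degInto G w C →
                             ∀ m → ∃[ j ] Adj G w (walk (2 * j)) × Adj G u (walk (2 * j + suc (2 * m)))
        oppositeNeighbours {u} {w} u≡q w≡¬q deg m = pigeonhole n (λ j → adj G w (walk (2 * j)))
          (λ j → adj G u (walk (2 * j + suc (2 * m)))) (subst (n <_) sums deg)
          where
            sums : degInto G u C + degInto G w C ≡
                   ∑[ j < n ] 𝟙 (adj G w (walk (2 * j))) + ∑[ j < n ] 𝟙 (adj G u (walk (2 * j + suc (2 * m))))
            sums = trans (+-comm (degInto G u C) _) (cong₂ _+_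
              (trans (degree w) (sumTo-evens n (adj G w ∘ walk) (λ _ → evenNeighbour w≡¬q)))
              (trans (degree u) (sumTo-odds n (adj G u ∘ walk) (cong (adj G u) ∘ periodic)
                                            (λ _ → oddNeighbour u≡q) m)))

        walk-distinct : ∀ a {t t'} → t < t' → t' < 2 * n → walk a ≢ walk (a + (t' ∸ t))
        walk-distinct a {t} {t'} t<t' t'<2n eq =
          <⇒≢ (m<n⇒0<n∸m t<t') (sym (injective eq (≤-<-trans (m∸n≤m t' t) t'<2n)))

        ascendingSegment : ∀ s m → isEven s ≡ true → 2 + 2 * m ≤ 2 * n →
                           IsMPath G M (applyUpTo (λ t → walk (s + t)) (2 + 2 * m))
        ascendingSegment s m s-even fits = applyUpTo-MPath (λ t → walk (s + t)) m
          (λ {t} _ → subst (Adj G (walk (s + t))) (cong walk (sym (+-suc s t))) (adjacent (s + t)))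
          (λ {t} _ → trans (cong (inM M (walk (s + t)) ∘ walk) (+-suc s t))
                           (trans (alternating (s + t)) (isEven-even+ s t s-even)))
          (λ {t} {t'} t<t' t'<2+2m eq → walk-distinct (s + t) t<t' (<-≤-trans t'<2+2m fits)
            (trans eq (cong walk (trans (cong (s +_) (sym (m+[n∸m]≡n (<⇒≤ t<t')))) (sym (+-assoc s t (t' ∸ t)))))))

        -- Since s + 2m is even, the M-edges of the reversed segment again leave its even positions.
        descendingSegment : ∀ s m → isEven s ≡ true → 2 + 2 * m ≤ 2 * n →
                            IsMPath G M (applyUpTo (λ t → walk (suc (s + 2 * m) ∸ t)) (2 + 2 * m))
        descendingSegment s m s-even fits = applyUpTo-MPath (λ t → walk (suc b ∸ t)) m
          (λ {t} t<1+2m → subst (λ v → Adj G v (walk (b ∸ t))) (cong walk (sym (top∸ t<1+2m)))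
                                (Adj-sym (adjacent (b ∸ t))))
          (λ {t} t<1+2m → trans (cong (λ v → inM M (walk v) (walk (b ∸ t))) (top∸ t<1+2m))
                            (trans (inM-sym M _ _) (trans (alternating (b ∸ t)) (isEven-∸ t (t≤b t<1+2m) b-even))))
          (λ {t} {t'} t<t' t'<2+2m eq → walk-distinct (suc b ∸ t') t<t' (<-≤-trans t'<2+2m fits)
            (trans (sym eq) (cong walk (split t<t' (≤-trans (≤-pred t'<2+2m) (s≤s (m≤n+m (2 * m) s)))))))
          where
            b : ℕ
            b = s + 2 * m
            b-even : isEven b ≡ true
            b-even = trans (isEven-even+ s (2 * m) s-even) (isEven-2* m)
            t≤b : ∀ {t} → t < suc (2 * m) → t ≤ b
            t≤b t<1+2m = ≤-trans (≤-pred t<1+2m) (m≤n+m (2 * m) s)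
            top∸ : ∀ {t} → t < suc (2 * m) → suc b ∸ t ≡ suc (b ∸ t)
            top∸ t<1+2m = +-∸-assoc 1 (t≤b t<1+2m)
            split : ∀ {t t'} → t < t' → t' ≤ suc b → suc b ∸ t ≡ (suc b ∸ t') + (t' ∸ t)
            split {t} {t'} t<t' t'≤1+b =
              trans (cong (_∸ t) (sym (m∸n+n≡m t'≤1+b))) (+-∸-assoc (suc b ∸ t') (<⇒≤ t<t'))

      cycleThrough : ∀ {C n x r} → AlternatingTraversal C n → IsMPath G M (x ∷ r) → All (_∉ C) (x ∷ r) →
                     n < degInto G x C + degInto G (lastOf x r) C → ∀ m → suc m ≤ n →
                     CycleThrough (x ∷ r) C (length (x ∷ r) + 2 * suc m)
      cycleThrough {C} {n} {x} {r} T P-path P∉C deg m 1+m≤n = byColour (col x ≟ᵇ col (walk 0))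
        where
          open AlternatingTraversal T
          y : Fin N
          y = lastOf x r
          Goal : Set
          Goal = CycleThrough (x ∷ r) C (length (x ∷ r) + 2 * suc m)
          fits : 2 + 2 * m ≤ 2 * n
          fits = subst (_≤ 2 * n) (*-suc 2 m) (*-monoʳ-≤ 2 1+m≤n)
          closeWith : ∀ (e : ℕ → Fin N) → IsMPath G M (applyUpTo e (2 + 2 * m)) → (∀ t → e t ∈ C) →
                      Adj G y (e 0) → Adj G x (e (suc (2 * m))) → Goal
          closeWith e S-path S⊆C ye xe = subst (CycleThrough (x ∷ r) C)
            (cong (length (x ∷ r) +_) (trans (length-applyUpTo e (2 + 2 * m)) (sym (*-suc 2 m))))
            (spliceSegment P-path P∉C S-path (Allₚ.applyUpTo⁺₂ e (2 + 2 * m) S⊆C) ye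
               (subst (λ v → Adj G v x) (sym (lastOf-applyUpTo e (suc (2 * m)))) (Adj-sym xe)))
          ascending : ∃[ j ] Adj G y (walk (2 * j)) × Adj G x (walk (2 * j + suc (2 * m))) → Goal
          ascending (j , yj , xj) =
            closeWith (λ t → walk (2 * j + t)) (ascendingSegment T (2 * j) m (isEven-2* j) fits) (λ _ → onCycle _)
              (subst (Adj G y ∘ walk) (sym (+-identityʳ (2 * j))) yj) xj
          descending : ∃[ j ] Adj G x (walk (2 * j)) × Adj G y (walk (2 * j + suc (2 * m))) → Goal
          descending (j , xj , yj) =
            closeWith (λ t → walk (suc (2 * j + 2 * m) ∸ t)) (descendingSegment T (2 * j) m (isEven-2* j) fits)
              (λ _ → onCycle _) (subst (Adj G y ∘ walk) (+-suc (2 * j) (2 * m)) yj)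
              (subst (Adj G x ∘ walk) (sym (m+n∸n≡m (2 * j) (2 * m))) xj)
          byColour : Dec (col x ≡ col (walk 0)) → Goal
          byColour (yes x≡q) = ascending (oppositeNeighbours T x≡q (trans (MPath-endColour P-path) (cong not x≡q)) deg m)
          byColour (no  x≢q) = descending (oppositeNeighbours T
            (trans (MPath-endColour P-path) (trans (cong not (¬-not x≢q)) (not-involutive _))) (¬-not x≢q)
            (subst (n <_) (+-comm (degInto G x C) _) deg) m)

lemma1 : {N : ℕ} (G : Graph N) → Bipartite G → (M : Matching G)
    → (C : List (Fin N)) → IsMCycle G M C
    → (x y : Fin N) (mid : List (Fin N))
    → IsMPath G M (x ∷ mid ∷ʳ y)
    → All (λ v → v ∉ C) (x ∷ mid ∷ʳ y)
    → length C / 2 < degInto G x C + degInto G y C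
    → (i : ℕ) → 1 ≤ i → i ≤ length C / 2
    → Σ (List (Fin N)) λ D →
        IsMCycle G M D
        × All (λ v → v ∈ (x ∷ mid ∷ʳ y) ++ C) D
        × length D ≡ length (x ∷ mid ∷ʳ y) + 2 * i
lemma1 _ _ _ _ _ _ _ _ _ _ _ zero () _
lemma1 G (col , proper) M C C-cycle x y mid P-path P∉C deg (suc m) _ 1+m≤half =
  cycleThrough G M col proper (MCycle-traversal G M C-cycle) P-path P∉C
    (subst₂ (λ h z → h < degInto G x C + degInto G z C) half (sym (lastOf-++ x mid (y ∷ []))) deg)
    m (subst (suc m ≤_) half 1+m≤half)
  where
    n : ℕ
    n = countM G M (cycEdges C)
    half : length C / 2 ≡ n
    half = trans (cong (_/ 2) (trans (sym (proj₂ C-cycle)) (*-comm 2 n))) (m*n/n≡m n 2)
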